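{- Let $n\ge2$. If $\lambda$ is proper, then its reverse-complement $\lambda^{rc}$ is proper, $\mu(21,\lambda)=\mu(21,\lambda^{rc})$, and $S_\lambda=S_{\lambda^{rc}}$, where $S_\lambda=\sum_{\tau\in[\lambda,\pi_n]}(-1)^{|\tau|}E(\tau,\pi_n)$.
   Context: Permutations of size $m$ are bijections of $[m]$ written as value sequences. An embedding of $\sigma\in\mathcal{S}_k$ into $\pi\in\mathcal{S}_N$ is a strictly increasing $f\colon[k]\to[N]$ with $\pi(f(1)),\dots,\pi(f(k))$ order-isomorphic to $\sigma$; $E(\sigma,\pi)$ is the number of embeddings; $\sigma\le\pi$ iff $E(\sigma,\pi)>0$; $[x,y]=\{z:x\le z\le y\}$, $[x,y)=\{z:x\le z<y\}$; $\mu$ is the Möbius function of this poset. The reverse-complement of $\lambda\in\mathcal{S}_m$ is $\lambda^{rc}(i)=m+1-\lambda(m+1-i)$. For $n\ge1$, $\pi_n\in\mathcal{S}_{2n+2}$ is given by $\pi_n(1)=n+1$, $\pi_n(2i)=i$ and $\pi_n(2i+1)=n+2+i$ for $1\le i\le n$, $\pi_n(2n+2)=n+2$. An inverse descent of $\lambda$ is a pair $i<j$ with $\lambda(i)=\lambda(j)+1$. If $\lambda$ has exactly one inverse descent, at $i<j$, then $\lambda(k)$ is a top element if $\lambda(k)\ge\lambda(i)$ and a bottom element if $\lambda(k)\le\lambda(j)$; a top (bottom) repetition is a pair of consecutive elements $\lambda(k),\lambda(k+1)$ that are both top (bottom) elements. A permutation $\lambda\in[21,\pi_n)$ of size $m$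 is proper if: (1) $\lambda$ has exactly one inverse descent; (2) $\lambda(1)$ and $\lambda(m-1)$ are top elements and $\lambda(2)$ and $\lambda(m)$ are bottom elements (for $m=2$ this means $\lambda=21$); (3) $\lambda$ has at most one top repetition and at most one bottom repetition, and if it has both, the top repetition is to the left of the bottom repetition. -}

module Defs where

open import Data.Bool using (Bool; true; false; _∧_; if_then_else_; not; T)
open import Data.Nat using (ℕ; zero; suc; _+_; _∸_; _≤_; _<_; _≡ᵇ_; _<ᵇ_; _≤ᵇ_)
open import Data.Integer as ℤ using (ℤ)
open import Data.List using (List; []; _∷_; _++_; map; length; filter; reverse; foldr; upTo; concat; deduplicateᵇ)
open import Data.List.Relation.Unary.All using (All)
open import Data.List.Relation.Unary.Unique.Propositional using (Unique)
open import Data.Product using (Σ; _×_)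
open import Relation.Binary.PropositionalEquality using (_≡_; _≢_)
open import Relation.Nullary using (¬_)

Perm : Set
Perm = List ℕ

IsPerm : List ℕ → Set
IsPerm l = Unique l × All (λ x → 1 ≤ x × x ≤ length l) l

-- 1-indexed entry access (0 outside the range 1..m)
at : List ℕ → ℕ → ℕ
at [] _ = 0
at (x ∷ xs) zero = 0
at (x ∷ xs) (suc zero) = x
at (x ∷ xs) (suc (suc k)) = at xs (suc k)

-- all subsequences, one per index subset (i.e. per strictly increasing f)
subs : List ℕ → List (List ℕ)
subs [] = [] ∷ []
subs (x ∷ xs) = map (x ∷_) (subs xs) ++ subs xs

eqL : List ℕ → List ℕ → Bool
eqL [] [] = true
eqL (x ∷ xs) (y ∷ ys) = (x ≡ᵇ y) ∧ eqL xs ys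
eqL _ _ = false

eqB : Bool → Bool → Bool
eqB true b = b
eqB false b = not b

allB : {A : Set} → (A → Bool) → List A → Bool
allB p [] = true
allB p (x ∷ xs) = p x ∧ allB p xs

orderIso : List ℕ → List ℕ → Bool
orderIso a b = (length a ≡ᵇ length b) ∧
  allB (λ i → allB (λ j → eqB (at a (suc i) <ᵇ at a (suc j)) (at b (suc i) <ᵇ at b (suc j)))
                 (upTo (length a)))
      (upTo (length a))

count : {A : Set} → (A → Bool) → List A → ℕ
count p [] = 0
count p (x ∷ xs) = if p x then suc (count p xs) else count p xs

E : Perm → Perm → ℕ
E σ π = count (λ s → orderIso s σ) (subs π)

_≼_ : Perm → Perm → Set
σ ≼ π = 0 < E σ π

≼ᵇ : Perm → Perm → Bool
≼ᵇ σ π = 0 <ᵇ E σ π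

st : List ℕ → List ℕ
st l = map (λ x → count (λ y → y ≤ᵇ x) l) l

patterns : Perm → List Perm
patterns π = deduplicateᵇ eqL (map st (subs π))

sumℤ : List ℤ → ℤ
sumℤ = foldr ℤ._+_ (ℤ.+ 0)

-- Möbius function of the pattern poset:
-- μ(x,x) = 1, μ(x,y) = - Σ_{z ∈ [x,y)} μ(x,z) for x < y, μ(x,y) = 0 otherwise.
-- The fuel argument bounds the recursion (strictly decreasing size of y).
muF : ℕ → Perm → Perm → ℤ
muF fuel x y with ≼ᵇ x y | eqL x y
... | false | _ = ℤ.+ 0
... | true | true = ℤ.+ 1
... | true | false with fuel
...   | zero = ℤ.+ 0
...   | suc f = ℤ.- sumℤ (map (muF f x)
                 (filter (λ z → T? ((≼ᵇ x z) ∧ not (eqL z y))) (patterns y)))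
  where
  open import Relation.Nullary.Decidable using () renaming (T? to T?)
  
μ : Perm → Perm → ℤ
μ x y = muF (suc (length y)) x y

πn : ℕ → Perm
πn n = (suc n) ∷ (concat (map (λ k → suc k ∷ (n + 2 + suc k) ∷ []) (upTo n)) ++ (n + 2 ∷ []))

rc : Perm → Perm
rc l = map (λ x → suc (length l) ∸ x) (reverse l)

p21 : Perm
p21 = 2 ∷ 1 ∷ []

sgn : ℕ → ℤ
sgn zero = ℤ.+ 1
sgn (suc k) = ℤ.- sgn k

S : ℕ → Perm → ℤ
S n λ' = sumℤ (map (λ τ → sgn (length τ) ℤ.* ℤ.+ (E τ (πn n)))
                  (filter (λ τ → T? (≼ᵇ λ' τ)) (patterns (πn n))))
  where
  open import Relation.Nullary.Decidable using () renaming (T? to T?)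

InvDesc : Perm → ℕ → ℕ → Set
InvDesc l i j = 1 ≤ i × i < j × j ≤ length l × at l i ≡ suc (at l j)

Top Bot : Perm → ℕ → ℕ → ℕ → Set
Top l i j k = at l i ≤ at l k
Bot l i j k = at l k ≤ at l j

TopRep BotRep : Perm → ℕ → ℕ → ℕ → Set
TopRep l i j k = 1 ≤ k × suc k ≤ length l × Top l i j k × Top l i j (suc k)
BotRep l i j k = 1 ≤ k × suc k ≤ length l × Bot l i j k × Bot l i j (suc k)

Proper : ℕ → Perm → Set
Proper n l =
  IsPerm l × p21 ≼ l × l ≼ πn n × l ≢ πn n ×
  Σ ℕ λ i → Σ ℕ λ j →
    (InvDesc l i j × (∀ i' j' → InvDesc l i' j' → i' ≡ i × j' ≡ j)) ×
    (Top l i j 1 × Top l i j (length l ∸ 1) × Bot l i j 2 × Bot l i j (length l)) ×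
    (∀ k k' → TopRep l i j k → TopRep l i j k' → k ≡ k') ×
    (∀ k k' → BotRep l i j k → BotRep l i j k' → k ≡ k') ×
    (∀ k k' → TopRep l i j k → BotRep l i j k' → k < k')

module Submission where

-- Reverse-complement, x ↦ m + 1 − x applied to the values of a sequence read backwards, maps
-- the subsequences of π bijectively onto those of rc π and preserves order-isomorphism, so
-- E(rc σ, rc π) = E(σ, π): rc is an automorphism of the pattern poset. Since rc 21 = 21 and
-- rc π_n = π_n, the Möbius function μ(21, ·) and the sums S are rc-invariant. On a proper λ
-- of size m, rc moves the inverse descent (i, j) to (m + 1 − j, m + 1 − i), exchanges top
-- and bottom elements and reverses positions; a top repetition at k becomes a bottom
-- repetition at m − k and vice versa, so conditions (1)–(3) are preserved.

open import Defs
open import Data.Bool using (Bool; true; false; _∧_; not; T; if_then_else_)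
open import Data.Bool.Properties using (T-∧)
open import Data.Unit using (tt)
open import Data.Nat using (ℕ; zero; suc; _+_; _∸_; _≤_; _<_; z≤n; s≤s; s≤s⁻¹; _<ᵇ_; _≤ᵇ_)
open import Data.Nat.Properties
open import Data.Nat.Tactic.RingSolver using (solve-∀)
open import Algebra.Properties.CommutativeSemigroup +-commutativeSemigroup using (interchange)
open import Data.Integer as ℤ using (ℤ)
import Data.Integer.Properties as ℤP
open import Data.List
open import Data.List.Properties
open import Data.List.Relation.Unary.All as All using (All; []; _∷_)
import Data.List.Relation.Unary.All.Properties as All
open import Data.List.Relation.Unary.Any using (here; there)
open import Data.List.Relation.Unary.AllPairs using ([]; _∷_)
open import Data.List.Relation.Unary.Unique.Propositional using (Unique)
import Data.List.Relation.Unary.Unique.Propositional.Properties as Unique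
open import Data.List.Membership.Propositional using (_∈_; _∉_)
open import Data.List.Membership.Propositional.Properties
import Data.List.Membership.Setoid.Properties as SetoidMembership
open import Data.List.Membership.Propositional.Properties.WithK using (unique∧set⇒bag)
open import Data.List.Relation.Binary.BagAndSetEquality using (∼bag⇒↭)
open import Data.List.Relation.Binary.Permutation.Propositional
  using (_↭_; ↭-refl; ↭-sym; ↭-trans; ↭-reflexive; prep; swap; ↭⇒↭ₛ; module PermutationReasoning)
open import Data.List.Relation.Binary.Permutation.Propositional.Properties
  using (map⁺; filter-↭; ++⁺ˡ; ++⁺; shifts; ↭-reverse; ∈-resp-↭)
import Data.List.Relation.Binary.Permutation.Propositional as ↭
import Data.List.Relation.Binary.Permutation.Setoid.Properties as SetoidPerm
open import Data.Product using (_,_; proj₁; proj₂; ∃; _×_; uncurry)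
open import Data.Sum using (_⊎_; inj₁; inj₂)
open import Data.Empty using (⊥-elim)
open import Function using (_∘_; id; _⇔_; mk⇔; Equivalence)
open import Relation.Nullary using (¬_; Dec; ¬?)
open import Relation.Nullary.Decidable using (T?)
open import Relation.Binary.Definitions using (tri<; tri≈; tri>)
open import Relation.Binary.PropositionalEquality

private
  variable
    A B : Set

-- Counting and sums

T-injective : ∀ {a b} → (T a → T b) → (T b → T a) → a ≡ b
T-injective {false} {false} _ _ = refl
T-injective {false} {true}  _ g = ⊥-elim (g tt)
T-injective {true}  {false} f _ = ⊥-elim (f tt)
T-injective {true}  {true}  _ _ = refl

T⇒≡true : ∀ {b} → T b → b ≡ true
T⇒≡true {true} _ = refl

¬T⇒≡false : ∀ {b} → ¬ T b → b ≡ false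
¬T⇒≡false {false} _ = refl
¬T⇒≡false {true}  h = ⊥-elim (h tt)

count-↭ : ∀ (p : A → Bool) {xs ys} → xs ↭ ys → count p xs ≡ count p ys
count-↭ p ↭.refl        = refl
count-↭ p (prep x r)       = cong (λ k → if p x then suc k else k) (count-↭ p r)
count-↭ p (swap x y r) with p x | p y
... | true  | true  = cong (suc ∘ suc) (count-↭ p r)
... | true  | false = cong suc (count-↭ p r)
... | false | true  = cong suc (count-↭ p r)
... | false | false = count-↭ p r
count-↭ p (↭.trans r s) = trans (count-↭ p r) (count-↭ p s)

count-map : ∀ (p : B → Bool) (f : A → B) xs → count p (map f xs) ≡ count (p ∘ f) xs
count-map p f []       = refl
count-map p f (x ∷ xs) = cong (λ k → if p (f x) then suc k else k) (count-map p f xs)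

count-cong : ∀ (p q : A → Bool) xs → (∀ {x} → x ∈ xs → p x ≡ q x) → count p xs ≡ count q xs
count-cong p q []       _ = refl
count-cong p q (x ∷ xs) h rewrite h (here refl) =
  cong (λ k → if q x then suc k else k) (count-cong p q xs (h ∘ there))

count-≤-length : ∀ (p : A → Bool) xs → count p xs ≤ length xs
count-≤-length p []       = z≤n
count-≤-length p (x ∷ xs) with p x
... | true  = s≤s (count-≤-length p xs)
... | false = m≤n⇒m≤1+n (count-≤-length p xs)

count-pos : ∀ (p : A → Bool) {xs y} → y ∈ xs → T (p y) → 0 < count p xs
count-pos p {x ∷ xs} (here refl) py rewrite T⇒≡true py = s≤s z≤n
count-pos p {x ∷ xs} (there y∈) py with p x
... | true  = s≤s z≤n
... | false = count-pos p y∈ py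

count-mono : ∀ (p q : A → Bool) xs → (∀ {x} → T (p x) → T (q x)) → count p xs ≤ count q xs
count-mono p q []       p⇒q = z≤n
count-mono p q (x ∷ xs) p⇒q with p x in px | q x in qx
... | true  | true  = s≤s (count-mono p q xs p⇒q)
... | true  | false = ⊥-elim (subst T qx (p⇒q (subst T (sym px) tt)))
... | false | true  = m≤n⇒m≤1+n (count-mono p q xs p⇒q)
... | false | false = count-mono p q xs p⇒q

count-strict : ∀ (p q : A → Bool) {xs y} → (∀ {x} → T (p x) → T (q x)) →
               y ∈ xs → T (q y) → ¬ T (p y) → count p xs < count q xs
count-strict p q {x ∷ xs} p⇒q (here refl) qy ¬py
  rewrite T⇒≡true qy | ¬T⇒≡false ¬py = s≤s (count-mono p q xs p⇒q)
count-strict p q {x ∷ xs} p⇒q (there y∈) qy ¬py with p x in px | q x in qx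
... | true  | true  = s≤s (count-strict p q p⇒q y∈ qy ¬py)
... | true  | false = ⊥-elim (subst T qx (p⇒q (subst T (sym px) tt)))
... | false | true  = m≤n⇒m≤1+n (count-strict p q p⇒q y∈ qy ¬py)
... | false | false = count-strict p q p⇒q y∈ qy ¬py

sumℤ-↭ : ∀ {xs ys} → xs ↭ ys → sumℤ xs ≡ sumℤ ys
sumℤ-↭ p = SetoidPerm.foldr-commMonoid (setoid ℤ) ℤP.+-0-isCommutativeMonoid (↭⇒↭ₛ p)

sumWhere : (A → ℤ) → (A → Bool) → List A → ℤ
sumWhere g p xs = sumℤ (map g (filter (T? ∘ p) xs))

sumWhere-↭ : ∀ (g : A → ℤ) p {xs ys} → xs ↭ ys → sumWhere g p xs ≡ sumWhere g p ys
sumWhere-↭ g p r = sumℤ-↭ (map⁺ g (filter-↭ (T? ∘ p) r))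

sumWhere-map : ∀ (g : B → ℤ) p (f : A → B) xs → sumWhere g p (map f xs) ≡ sumWhere (g ∘ f) (p ∘ f) xs
sumWhere-map g p f []       = refl
sumWhere-map g p f (x ∷ xs) with p (f x)
... | true  = cong (λ s → g (f x) ℤ.+ s) (sumWhere-map g p f xs)
... | false = sumWhere-map g p f xs

sumWhere-cong : ∀ (g g′ : A → ℤ) (p p′ : A → Bool) xs →
                (∀ {x} → x ∈ xs → p x ≡ p′ x × g x ≡ g′ x) → sumWhere g p xs ≡ sumWhere g′ p′ xs
sumWhere-cong g g′ p p′ []       h = refl
sumWhere-cong g g′ p p′ (x ∷ xs) h with h (here refl)
... | p≡ , g≡ rewrite p≡ with p′ x
... | true  = cong₂ ℤ._+_ g≡ (sumWhere-cong g g′ p p′ xs (h ∘ there))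
... | false = sumWhere-cong g g′ p p′ xs (h ∘ there)

-- Positions and order isomorphism

nth : List ℕ → ℕ → ℕ
nth l i = at l (suc i)

nth-map : ∀ (f : ℕ → ℕ) l {i} → i < length l → nth (map f l) i ≡ f (nth l i)
nth-map f (x ∷ xs) {zero}  _       = refl
nth-map f (x ∷ xs) {suc i} (s≤s h) = nth-map f xs h

nth-++ˡ : ∀ a b {i} → i < length a → nth (a ++ b) i ≡ nth a i
nth-++ˡ (x ∷ a) b {zero}  _       = refl
nth-++ˡ (x ∷ a) b {suc i} (s≤s h) = nth-++ˡ a b h

nth-++ʳ : ∀ a b i → nth (a ++ b) (length a + i) ≡ nth b i
nth-++ʳ []      b i = refl
nth-++ʳ (x ∷ a) b i = nth-++ʳ a b i

nth-All : ∀ {P : ℕ → Set} {l i} → All P l → i < length l → P (nth l i)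
nth-All {i = zero}  (px ∷ _)  _       = px
nth-All {i = suc i} (_  ∷ pl) (s≤s h) = nth-All pl h

mirror : ℕ → ℕ → ℕ
mirror n i = n ∸ suc i

mirror-< : ∀ {n i} → i < n → mirror n i < n
mirror-< {suc n} {i} _ = s≤s (m∸n≤m n i)

mirror-involutive : ∀ {n i} → i < n → mirror n (mirror n i) ≡ i
mirror-involutive {suc n} (s≤s h) = m∸[m∸n]≡n h

∸≡suc-mirror : ∀ {n i} → i < n → n ∸ i ≡ suc (mirror n i)
∸≡suc-mirror {suc n} {zero}  _       = refl
∸≡suc-mirror {suc n} {suc i} (s≤s h) = ∸≡suc-mirror h

nth-reverse : ∀ l {i} → i < length l → nth (reverse l) i ≡ nth l (mirror (length l) i)
nth-reverse (x ∷ xs) {i} h rewrite unfold-reverse x xs with <-cmp i (length xs)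
... | tri< i<n _ _ = begin
  nth (reverse xs ++ x ∷ []) i   ≡⟨ nth-++ˡ (reverse xs) _ (subst (i <_) (sym (length-reverse xs)) i<n) ⟩
  nth (reverse xs) i             ≡⟨ nth-reverse xs i<n ⟩
  nth xs (mirror (length xs) i)  ≡⟨ cong (nth (x ∷ xs)) (sym (∸≡suc-mirror i<n)) ⟩
  nth (x ∷ xs) (length xs ∸ i)   ∎
  where open ≡-Reasoning
... | tri≈ _ refl _ = begin
  nth (reverse xs ++ x ∷ []) (length xs)
    ≡⟨ cong (nth (reverse xs ++ x ∷ [])) (sym (+-identityʳ _)) ⟩
  nth (reverse xs ++ x ∷ []) (length xs + 0)
    ≡⟨ cong (λ k → nth (reverse xs ++ x ∷ []) (k + 0)) (sym (length-reverse xs)) ⟩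
  nth (reverse xs ++ x ∷ []) (length (reverse xs) + 0)
    ≡⟨ nth-++ʳ (reverse xs) (x ∷ []) 0 ⟩
  x
    ≡⟨ cong (nth (x ∷ xs)) (sym (n∸n≡0 (length xs))) ⟩
  nth (x ∷ xs) (length xs ∸ length xs) ∎
  where open ≡-Reasoning
... | tri> _ _ i>n = ⊥-elim (<⇒≱ i>n (s≤s⁻¹ h))

T-allB : ∀ (p : A → Bool) xs → T (allB p xs) ⇔ (∀ {x} → x ∈ xs → T (p x))
T-allB p xs = mk⇔ (to xs) (from xs)
  where
  to : ∀ xs → T (allB p xs) → ∀ {x} → x ∈ xs → T (p x)
  to (y ∷ ys) h (here refl) = proj₁ (Equivalence.to T-∧ h)
  to (y ∷ ys) h (there x∈)  = to ys (proj₂ (Equivalence.to T-∧ h)) x∈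
  from : ∀ xs → (∀ {x} → x ∈ xs → T (p x)) → T (allB p xs)
  from []       h = tt
  from (y ∷ ys) h = Equivalence.from T-∧ (h (here refl) , from ys (h ∘ there))

T-eqB : ∀ {a b} → T (eqB a b) ⇔ a ≡ b
T-eqB {true}  {true}  = mk⇔ (λ _ → refl) (λ _ → tt)
T-eqB {true}  {false} = mk⇔ (λ ()) (λ ())
T-eqB {false} {true}  = mk⇔ (λ ()) (λ ())
T-eqB {false} {false} = mk⇔ (λ _ → refl) (λ _ → tt)

_<ᵇ[_]_ : ℕ → List ℕ → ℕ → Bool
i <ᵇ[ a ] j = nth a i <ᵇ nth a j

OrderIso : List ℕ → List ℕ → Set
OrderIso a b = length a ≡ length b ×
  (∀ {i j} → i < length a → j < length a → i <ᵇ[ a ] j ≡ i <ᵇ[ b ] j)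

T-orderIso : ∀ a b → T (orderIso a b) ⇔ OrderIso a b
T-orderIso a b = mk⇔ to from
  where
  to : T (orderIso a b) → OrderIso a b
  to h with Equivalence.to T-∧ h
  ... | len≡ , cmp≡ = ≡ᵇ⇒≡ _ _ len≡ , λ i< j< →
    Equivalence.to T-eqB (Equivalence.to (T-allB _ _)
      (Equivalence.to (T-allB _ _) cmp≡ (∈-upTo⁺ i<)) (∈-upTo⁺ j<))
  from : OrderIso a b → T (orderIso a b)
  from (len≡ , cmp≡) = Equivalence.from T-∧ (≡⇒≡ᵇ _ _ len≡ ,
    Equivalence.from (T-allB _ _) λ i∈ → Equivalence.from (T-allB _ _) λ j∈ →
      Equivalence.from T-eqB (cmp≡ (∈-upTo⁻ i∈) (∈-upTo⁻ j∈)))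

-- a′ is a read backwards with the order of the values reversed.
record Mirrored (n : ℕ) (a a′ : List ℕ) : Set where
  constructor mirrored
  field
    length-a  : length a ≡ n
    length-a′ : length a′ ≡ n
    compare   : ∀ {i j} → i < n → j < n → i <ᵇ[ a′ ] j ≡ mirror n j <ᵇ[ a ] mirror n i

Mirrored-sym : ∀ {n a a′} → Mirrored n a a′ → Mirrored n a′ a
Mirrored-sym {n} {a} {a′} (mirrored len len′ cmp) = mirrored len′ len λ {i} {j} i< j< → begin
  i <ᵇ[ a ] j
    ≡⟨ cong₂ (λ p q → p <ᵇ[ a ] q) (sym (mirror-involutive i<)) (sym (mirror-involutive j<)) ⟩
  mirror n (mirror n i) <ᵇ[ a ] mirror n (mirror n j)
    ≡⟨ sym (cmp (mirror-< j<) (mirror-< i<)) ⟩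
  mirror n j <ᵇ[ a′ ] mirror n i ∎
  where open ≡-Reasoning

OrderIso-mirror : ∀ {n a a′ b b′} → Mirrored n a a′ → Mirrored n b b′ → OrderIso a b → OrderIso a′ b′
OrderIso-mirror {n} {a} {a′} {b} {b′} (mirrored len len′ cmp) (mirrored _ lenᵇ′ cmpᵇ) (_ , iso) =
  trans len′ (sym lenᵇ′) , λ {i} {j} i< j< →
    let i<n = subst (i <_) len′ i< ; j<n = subst (j <_) len′ j<
        flip< : ∀ {k} → k < n → mirror n k < length a
        flip< k< = subst (_ <_) (sym len) (mirror-< k<)
    in begin
      i <ᵇ[ a′ ] j                    ≡⟨ cmp i<n j<n ⟩
      mirror n j <ᵇ[ a ] mirror n i  ≡⟨ iso (flip< j<n) (flip< i<n) ⟩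
      mirror n j <ᵇ[ b ] mirror n i  ≡⟨ sym (cmpᵇ i<n j<n) ⟩
      i <ᵇ[ b′ ] j                    ∎
  where open ≡-Reasoning

rc[_]_ : ℕ → List ℕ → List ℕ
rc[ M ] a = map (λ x → suc M ∸ x) (reverse a)

length-rc[] : ∀ M a → length (rc[ M ] a) ≡ length a
length-rc[] M a = trans (length-map _ (reverse a)) (length-reverse a)

length-rc : ∀ l → length (rc l) ≡ length l
length-rc l = length-rc[] (length l) l

∸-<ᵇ-flip : ∀ M {x y} → x ≤ M → y ≤ M → (suc M ∸ x <ᵇ suc M ∸ y) ≡ (y <ᵇ x)
∸-<ᵇ-flip M {x} {y} x≤M y≤M = T-injective to from
  where
  to : T (suc M ∸ x <ᵇ suc M ∸ y) → T (y <ᵇ x)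
  to h with <-cmp y x
  ... | tri< y<x _ _ = <⇒<ᵇ y<x
  ... | tri≈ _ refl _ = ⊥-elim (<-irrefl refl (<ᵇ⇒< (suc M ∸ x) _ h))
  ... | tri> _ _ y>x = ⊥-elim (<⇒≱ (<ᵇ⇒< _ _ h) (∸-monoʳ-≤ (suc M) (<⇒≤ y>x)))
  from : T (y <ᵇ x) → T (suc M ∸ x <ᵇ suc M ∸ y)
  from h = <⇒<ᵇ (∸-monoʳ-< (<ᵇ⇒< _ _ h) (m≤n⇒m≤1+n x≤M))

∸-≤ᵇ-flip : ∀ M {x y} → x ≤ M → (suc M ∸ y ≤ᵇ suc M ∸ x) ≡ (x ≤ᵇ y)
∸-≤ᵇ-flip M {x} {y} x≤M = T-injective to from
  where
  to : T (suc M ∸ y ≤ᵇ suc M ∸ x) → T (x ≤ᵇ y)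
  to h with <-cmp y x
  ... | tri< y<x _ _ = ⊥-elim (<⇒≱ (∸-monoʳ-< y<x (m≤n⇒m≤1+n x≤M)) (≤ᵇ⇒≤ _ _ h))
  ... | tri≈ _ refl _ = ≤⇒≤ᵇ (≤-refl {x})
  ... | tri> _ _ y>x = ≤⇒≤ᵇ (<⇒≤ y>x)
  from : T (x ≤ᵇ y) → T (suc M ∸ y ≤ᵇ suc M ∸ x)
  from h = ≤⇒≤ᵇ (∸-monoʳ-≤ (suc M) (≤ᵇ⇒≤ x y h))

nth-rc[] : ∀ M a {i} → i < length a → nth (rc[ M ] a) i ≡ suc M ∸ nth a (mirror (length a) i)
nth-rc[] M a {i} i< = trans (nth-map _ (reverse a) (subst (i <_) (sym (length-reverse a)) i<))
                            (cong (suc M ∸_) (nth-reverse a i<))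

rc[]-mirrored : ∀ M a → All (_≤ M) a → Mirrored (length a) a (rc[ M ] a)
rc[]-mirrored M a a≤M = mirrored refl (length-rc[] M a) λ i< j< →
  trans (cong₂ _<ᵇ_ (nth-rc[] M a i<) (nth-rc[] M a j<))
        (∸-<ᵇ-flip M (nth-All a≤M (mirror-< i<)) (nth-All a≤M (mirror-< j<)))

orderIso-rc[] : ∀ M M′ {a b} → All (_≤ M) a → All (_≤ M′) b →
                orderIso (rc[ M ] a) (rc[ M′ ] b) ≡ orderIso a b
orderIso-rc[] M M′ {a} {b} a≤M b≤M′ = T-injective
  (λ h → let iso′ = Equivalence.to (T-orderIso (rc[ M ] a) (rc[ M′ ] b)) h
             len≡ = trans (sym (length-rc[] M a)) (trans (proj₁ iso′) (length-rc[] M′ b))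
         in Equivalence.from (T-orderIso a b)
              (OrderIso-mirror (Mirrored-sym mir-a) (Mirrored-sym (mir-b (sym len≡))) iso′))
  (λ h → let iso = Equivalence.to (T-orderIso a b) h
         in Equivalence.from (T-orderIso (rc[ M ] a) (rc[ M′ ] b))
              (OrderIso-mirror mir-a (mir-b (sym (proj₁ iso))) iso))
  where
  mir-a = rc[]-mirrored M a a≤M
  mir-b : length b ≡ length a → Mirrored (length a) b (rc[ M′ ] b)
  mir-b eq = subst (λ n → Mirrored n b (rc[ M′ ] b)) eq (rc[]-mirrored M′ b b≤M′)

-- Subsequences and embeddings

subs-map : ∀ (f : ℕ → ℕ) xs → subs (map f xs) ≡ map (map f) (subs xs)
subs-map f []       = refl
subs-map f (x ∷ xs) = begin
  map (f x ∷_) (subs (map f xs)) ++ subs (map f xs)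
    ≡⟨ cong (λ ss → map (f x ∷_) ss ++ ss) (subs-map f xs) ⟩
  map (f x ∷_) (map (map f) (subs xs)) ++ map (map f) (subs xs)
    ≡⟨ cong (_++ map (map f) (subs xs)) (trans (sym (map-∘ (subs xs))) (map-∘ (subs xs))) ⟩
  map (map f) (map (x ∷_) (subs xs)) ++ map (map f) (subs xs)
    ≡⟨ sym (map-++ (map f) (map (x ∷_) (subs xs)) (subs xs)) ⟩
  map (map f) (map (x ∷_) (subs xs) ++ subs xs) ∎
  where open ≡-Reasoning

subs-∷ʳ : ∀ (ys : List ℕ) x → subs (ys ∷ʳ x) ↭ map (_∷ʳ x) (subs ys) ++ subs ys
subs-∷ʳ []       x = ↭-refl
subs-∷ʳ (y ∷ ys) x = begin
  map (y ∷_) (subs (ys ∷ʳ x)) ++ subs (ys ∷ʳ x)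
    ↭⟨ ++⁺ (map⁺ (y ∷_) (subs-∷ʳ ys x)) (subs-∷ʳ ys x) ⟩
  map (y ∷_) (map (_∷ʳ x) ss ++ ss) ++ (map (_∷ʳ x) ss ++ ss)
    ≡⟨ cong (_++ (map (_∷ʳ x) ss ++ ss)) (map-++ (y ∷_) (map (_∷ʳ x) ss) ss) ⟩
  (map (y ∷_) (map (_∷ʳ x) ss) ++ map (y ∷_) ss) ++ (map (_∷ʳ x) ss ++ ss)
    ↭⟨ middle-swap (map (y ∷_) (map (_∷ʳ x) ss)) (map (y ∷_) ss) (map (_∷ʳ x) ss) ss ⟩
  (map (y ∷_) (map (_∷ʳ x) ss) ++ map (_∷ʳ x) ss) ++ (map (y ∷_) ss ++ ss)
    ≡⟨ cong (λ zs → (zs ++ map (_∷ʳ x) ss) ++ (map (y ∷_) ss ++ ss))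
            (trans (sym (map-∘ ss)) (map-∘ ss)) ⟩
  (map (_∷ʳ x) (map (y ∷_) ss) ++ map (_∷ʳ x) ss) ++ (map (y ∷_) ss ++ ss)
    ≡⟨ cong (_++ (map (y ∷_) ss ++ ss)) (sym (map-++ (_∷ʳ x) (map (y ∷_) ss) ss)) ⟩
  map (_∷ʳ x) (map (y ∷_) ss ++ ss) ++ (map (y ∷_) ss ++ ss) ∎
  where
  open PermutationReasoning
  ss = subs ys
  middle-swap : ∀ (p q r t : List (List ℕ)) → (p ++ q) ++ (r ++ t) ↭ (p ++ r) ++ (q ++ t)
  middle-swap p q r t = ↭-trans (↭-reflexive (++-assoc p q (r ++ t)))
    (↭-trans (++⁺ˡ p (shifts q r)) (↭-reflexive (sym (++-assoc p r (q ++ t)))))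

subs-reverse : ∀ (xs : List ℕ) → subs (reverse xs) ↭ map reverse (subs xs)
subs-reverse []       = ↭-refl
subs-reverse (x ∷ xs) = begin
  subs (reverse (x ∷ xs))
    ≡⟨ cong subs (unfold-reverse x xs) ⟩
  subs (reverse xs ∷ʳ x)
    ↭⟨ subs-∷ʳ (reverse xs) x ⟩
  map (_∷ʳ x) (subs (reverse xs)) ++ subs (reverse xs)
    ↭⟨ ++⁺ (map⁺ (_∷ʳ x) (subs-reverse xs)) (subs-reverse xs) ⟩
  map (_∷ʳ x) (map reverse (subs xs)) ++ map reverse (subs xs)
    ≡⟨ cong (_++ map reverse (subs xs))
            (trans (sym (map-∘ (subs xs)))
            (trans (map-cong (λ s → sym (unfold-reverse x s)) (subs xs)) (map-∘ (subs xs)))) ⟩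
  map reverse (map (x ∷_) (subs xs)) ++ map reverse (subs xs)
    ≡⟨ sym (map-++ reverse (map (x ∷_) (subs xs)) (subs xs)) ⟩
  map reverse (subs (x ∷ xs)) ∎
  where open PermutationReasoning

subs-All : ∀ {P : ℕ → Set} {xs t} → t ∈ subs xs → All P xs → All P t
subs-All {xs = []}     (here refl) [] = []
subs-All {xs = x ∷ xs} t∈ (px ∷ pxs) with ∈-++⁻ (map (x ∷_) (subs xs)) t∈
... | inj₁ t∈₁ with ∈-map⁻ (x ∷_) t∈₁
...   | _ , t′∈ , refl = px ∷ subs-All t′∈ pxs
subs-All {xs = x ∷ xs} t∈ (px ∷ pxs) | inj₂ t∈₂ = subs-All t∈₂ pxs

subs-Unique : ∀ {xs t} → t ∈ subs xs → Unique xs → Unique t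
subs-Unique {[]}     (here refl) [] = []
subs-Unique {x ∷ xs} t∈ (x∉ ∷ u) with ∈-++⁻ (map (x ∷_) (subs xs)) t∈
... | inj₁ t∈₁ with ∈-map⁻ (x ∷_) t∈₁
...   | _ , t′∈ , refl = subs-All t′∈ x∉ ∷ subs-Unique t′∈ u
subs-Unique {x ∷ xs} t∈ (x∉ ∷ u) | inj₂ t∈₂ = subs-Unique t∈₂ u

Bounded : List ℕ → Set
Bounded l = All (_≤ length l) l

E-rc : ∀ {σ π} → Bounded σ → Bounded π → E (rc σ) (rc π) ≡ E σ π
E-rc {σ} {π} bσ bπ = begin
  count (λ s → orderIso s (rc σ)) (subs (rc π))
    ≡⟨ cong (count (λ s → orderIso s (rc σ))) (subs-map (λ x → suc (length π) ∸ x) (reverse π)) ⟩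
  count (λ s → orderIso s (rc σ)) (map (map (λ x → suc (length π) ∸ x)) (subs (reverse π)))
    ≡⟨ count-map _ _ (subs (reverse π)) ⟩
  count (λ s → orderIso (map (λ x → suc (length π) ∸ x) s) (rc σ)) (subs (reverse π))
    ≡⟨ count-↭ _ (subs-reverse π) ⟩
  count (λ s → orderIso (map (λ x → suc (length π) ∸ x) s) (rc σ)) (map reverse (subs π))
    ≡⟨ count-map _ reverse (subs π) ⟩
  count (λ s → orderIso (rc[ length π ] s) (rc σ)) (subs π)
    ≡⟨ count-cong _ _ (subs π) (λ t∈ → orderIso-rc[] (length π) (length σ) (subs-All t∈ bπ) bσ) ⟩
  count (λ s → orderIso s σ) (subs π) ∎
  where open ≡-Reasoning

-- Permutations under reverse-complement

IsPerm⇒Bounded : ∀ {l} → IsPerm l → Bounded l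
IsPerm⇒Bounded (_ , bounds) = All.map proj₂ bounds

rc-involutive : ∀ {l} → Bounded l → rc (rc l) ≡ l
rc-involutive {l} bl = begin
  map (λ x → suc (length (rc l)) ∸ x) (reverse (rc l))
    ≡⟨ cong (λ m → map (λ x → suc m ∸ x) (reverse (rc l))) (length-rc l) ⟩
  map c (reverse (map c (reverse l)))
    ≡⟨ cong (map c) (trans (sym (reverse-map c (reverse l))) (cong (map c) (reverse-involutive l))) ⟩
  map c (map c l)
    ≡⟨ sym (map-∘ l) ⟩
  map (c ∘ c) l
    ≡⟨ map-cong-local (All.map (m∸[m∸n]≡n ∘ m≤n⇒m≤1+n) bl) ⟩
  map id l
    ≡⟨ map-id l ⟩
  l ∎
  where
  open ≡-Reasoning
  c : ℕ → ℕ
  c x = suc (length l) ∸ x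

rc-injective : ∀ {a b} → Bounded a → Bounded b → rc a ≡ rc b → a ≡ b
rc-injective {a} {b} ba bb eq = trans (sym (rc-involutive ba)) (trans (cong rc eq) (rc-involutive bb))

Unique-map⁺-on : ∀ {f : A → B} {xs} → (∀ {x y} → x ∈ xs → y ∈ xs → f x ≡ f y → x ≡ y) →
                 Unique xs → Unique (map f xs)
Unique-map⁺-on {xs = []}     inj []        = []
Unique-map⁺-on {xs = x ∷ xs} inj (x∉ ∷ u) =
  All.map⁺ (All.tabulate (λ y∈ fx≡fy → All.lookup x∉ y∈ (inj (here refl) (there y∈) fx≡fy)))
  ∷ Unique-map⁺-on (λ x∈ y∈ → inj (there x∈) (there y∈)) u

Unique-reverse : ∀ {xs : List A} → Unique xs → Unique (reverse xs)
Unique-reverse {xs = xs} = SetoidPerm.Unique-resp-↭ (setoid _) (↭⇒↭ₛ (↭-sym (↭-reverse xs)))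

∈-reverse⁻ : ∀ {x : A} {xs} → x ∈ reverse xs → x ∈ xs
∈-reverse⁻ {xs = xs} = ∈-resp-↭ (↭-reverse xs)

IsPerm-rc : ∀ {l} → IsPerm l → IsPerm (rc l)
IsPerm-rc {l} (u , bounds) =
  Unique-map⁺-on complement-injective (Unique-reverse u) ,
  All.map⁺ (All.tabulate (λ x∈ → complement-bounds (All.lookup bounds (∈-reverse⁻ x∈))))
  where
  m = length l
  complement-injective : ∀ {x y} → x ∈ reverse l → y ∈ reverse l → suc m ∸ x ≡ suc m ∸ y → x ≡ y
  complement-injective x∈ y∈ eq =
    trans (sym (m∸[m∸n]≡n (m≤n⇒m≤1+n (proj₂ (All.lookup bounds (∈-reverse⁻ x∈))))))
      (trans (cong (suc m ∸_) eq) (m∸[m∸n]≡n (m≤n⇒m≤1+n (proj₂ (All.lookup bounds (∈-reverse⁻ y∈))))))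
  complement-bounds : ∀ {x} → 1 ≤ x × x ≤ m → 1 ≤ suc m ∸ x × suc m ∸ x ≤ length (rc l)
  complement-bounds {x} (1≤x , x≤m) =
    subst (1 ≤_) (sym (+-∸-assoc 1 x≤m)) (s≤s z≤n) ,
    subst (suc m ∸ x ≤_) (sym (length-rc l)) (∸-monoʳ-≤ (suc m) 1≤x)

-- Standardisation and patterns

indicator : Bool → ℕ
indicator b = if b then 1 else 0

count-∷ : ∀ (p : A → Bool) x xs → count p (x ∷ xs) ≡ indicator (p x) + count p xs
count-∷ p x xs with p x
... | true  = refl
... | false = refl

≤ᵇ-dichotomy : ∀ x w → w ≢ x → indicator (x ≤ᵇ w) + indicator (w ≤ᵇ x) ≡ 1
≤ᵇ-dichotomy x w w≢x with <-cmp w x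
... | tri< w<x _ _ rewrite ¬T⇒≡false (<⇒≱ w<x ∘ ≤ᵇ⇒≤ x w) | T⇒≡true (≤⇒≤ᵇ (<⇒≤ w<x)) = refl
... | tri≈ _ w≡x _ = ⊥-elim (w≢x w≡x)
... | tri> _ _ w>x rewrite ¬T⇒≡false (<⇒≱ w>x ∘ ≤ᵇ⇒≤ w x) | T⇒≡true (≤⇒≤ᵇ (<⇒≤ w>x)) = refl

≤ᵇ-refl : ∀ x → indicator (x ≤ᵇ x) ≡ 1
≤ᵇ-refl x rewrite T⇒≡true (≤⇒≤ᵇ (≤-refl {x})) = refl

-- Every entry other than x is counted exactly once, x itself twice.
count-≤ᵇ-∉ : ∀ x t → x ∉ t → count (x ≤ᵇ_) t + count (_≤ᵇ x) t ≡ length t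
count-≤ᵇ-∉ x []      _  = refl
count-≤ᵇ-∉ x (w ∷ t) x∉ rewrite count-∷ (x ≤ᵇ_) w t | count-∷ (_≤ᵇ x) w t =
  trans (interchange (indicator (x ≤ᵇ w)) _ (indicator (w ≤ᵇ x)) _)
        (cong₂ _+_ (≤ᵇ-dichotomy x w (x∉ ∘ here ∘ sym)) (count-≤ᵇ-∉ x t (x∉ ∘ there)))

count-≤ᵇ-∈ : ∀ x {t} → Unique t → x ∈ t → count (x ≤ᵇ_) t + count (_≤ᵇ x) t ≡ suc (length t)
count-≤ᵇ-∈ x {w ∷ t} (w∉ ∷ u) x∈ rewrite count-∷ (x ≤ᵇ_) w t | count-∷ (_≤ᵇ x) w t with x∈
... | here refl = trans (interchange (indicator (x ≤ᵇ x)) _ (indicator (x ≤ᵇ x)) _)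
    (cong₂ _+_ (cong₂ _+_ (≤ᵇ-refl x) (≤ᵇ-refl x)) (count-≤ᵇ-∉ x t (λ x∈t → All.lookup w∉ x∈t refl)))
... | there x∈t = trans (interchange (indicator (x ≤ᵇ w)) _ (indicator (w ≤ᵇ x)) _)
    (cong₂ _+_ (≤ᵇ-dichotomy x w (All.lookup w∉ x∈t)) (count-≤ᵇ-∈ x u x∈t))

st-rc[] : ∀ M {t} → Unique t → All (_≤ M) t → st (rc[ M ] t) ≡ rc (st t)
st-rc[] M {t} u t≤M = begin
  map (λ y → count (_≤ᵇ y) (rc[ M ] t)) (map c (reverse t))
    ≡⟨ sym (map-∘ (reverse t)) ⟩
  map (λ x → count (_≤ᵇ c x) (rc[ M ] t)) (reverse t)
    ≡⟨ map-cong-local (All.tabulate (rank-complement ∘ ∈-reverse⁻)) ⟩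
  map ((λ v → suc (length t) ∸ v) ∘ rank) (reverse t)
    ≡⟨ map-∘ (reverse t) ⟩
  map (λ v → suc (length t) ∸ v) (map rank (reverse t))
    ≡⟨ cong₂ (λ m ys → map (λ v → suc m ∸ v) ys) (sym (length-map rank t)) (reverse-map rank t) ⟩
  rc (st t) ∎
  where
  open ≡-Reasoning
  c : ℕ → ℕ
  c x = suc M ∸ x
  rank : ℕ → ℕ
  rank x = count (_≤ᵇ x) t
  rank-complement : ∀ {x} → x ∈ t → count (_≤ᵇ c x) (rc[ M ] t) ≡ suc (length t) ∸ rank x
  rank-complement {x} x∈ = begin
    count (_≤ᵇ c x) (map c (reverse t))   ≡⟨ count-map _ c (reverse t) ⟩
    count (λ w → c w ≤ᵇ c x) (reverse t)  ≡⟨ count-↭ _ (↭-reverse t) ⟩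
    count (λ w → c w ≤ᵇ c x) t            ≡⟨ count-cong _ _ t (λ _ → ∸-≤ᵇ-flip M (All.lookup t≤M x∈)) ⟩
    count (x ≤ᵇ_) t                       ≡⟨ sym (m+n∸n≡m _ (rank x)) ⟩
    count (x ≤ᵇ_) t + rank x ∸ rank x     ≡⟨ cong (_∸ rank x) (count-≤ᵇ-∈ x u x∈) ⟩
    suc (length t) ∸ rank x               ∎

st-IsPerm : ∀ {t} → Unique t → IsPerm (st t)
st-IsPerm {t} u =
  Unique-map⁺-on rank-injective u ,
  All.map⁺ (All.tabulate (λ {x} x∈ →
    count-pos (_≤ᵇ x) x∈ (≤⇒≤ᵇ (≤-refl {x})) ,
    subst (count (_≤ᵇ x) t ≤_) (sym (length-map _ t)) (count-≤-length _ t)))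
  where
  rank-mono : ∀ {x y} → y ∈ t → x < y → count (_≤ᵇ x) t < count (_≤ᵇ y) t
  rank-mono {x} {y} y∈ x<y = count-strict (_≤ᵇ x) (_≤ᵇ y)
    (λ {w} w≤x → ≤⇒≤ᵇ (≤-trans (≤ᵇ⇒≤ w x w≤x) (<⇒≤ x<y))) y∈ (≤⇒≤ᵇ (≤-refl {y}))
    (<⇒≱ x<y ∘ ≤ᵇ⇒≤ y x)
  rank-injective : ∀ {x y} → x ∈ t → y ∈ t → count (_≤ᵇ x) t ≡ count (_≤ᵇ y) t → x ≡ y
  rank-injective {x} {y} x∈ y∈ eq with <-cmp x y
  ... | tri< x<y _ _ = ⊥-elim (<-irrefl eq (rank-mono y∈ x<y))
  ... | tri≈ _ x≡y _ = x≡y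
  ... | tri> _ _ x>y = ⊥-elim (<-irrefl (sym eq) (rank-mono x∈ x>y))

T-eqL : ∀ x y → T (eqL x y) ⇔ x ≡ y
T-eqL x y = mk⇔ (sound x y) (λ { refl → complete x })
  where
  sound : ∀ x y → T (eqL x y) → x ≡ y
  sound []      []      _ = refl
  sound (a ∷ x) (b ∷ y) h with Equivalence.to T-∧ h
  ... | a≡b , x≡y = cong₂ _∷_ (≡ᵇ⇒≡ a b a≡b) (sound x y x≡y)
  complete : ∀ x → T (eqL x x)
  complete []      = tt
  complete (a ∷ x) = Equivalence.from T-∧ (≡⇒≡ᵇ a a refl , complete x)

eqL-rc : ∀ {x y} → Bounded x → Bounded y → eqL (rc x) (rc y) ≡ eqL x y
eqL-rc {x} {y} bx by = T-injective
  (Equivalence.from (T-eqL x y) ∘ rc-injective bx by ∘ Equivalence.to (T-eqL (rc x) (rc y)))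
  (Equivalence.from (T-eqL (rc x) (rc y)) ∘ cong rc ∘ Equivalence.to (T-eqL x y))

eqL? : ∀ x y → Dec (T (eqL x y))
eqL? x y = T? (eqL x y)

∈-dedup⁻ : ∀ xs {z} → z ∈ deduplicateᵇ eqL xs → z ∈ xs
∈-dedup⁻ = ∈-deduplicate⁻ eqL?

∈-dedup⁺ : ∀ {xs z} → z ∈ xs → z ∈ deduplicateᵇ eqL xs
∈-dedup⁺ = SetoidMembership.∈-deduplicate⁺ (setoid (List ℕ)) eqL?
  (λ {_} {y} {z} zRy x≡y → trans x≡y (sym (Equivalence.to (T-eqL z y) zRy)))

Unique-dedup : ∀ xs → Unique (deduplicateᵇ eqL xs)
Unique-dedup []       = []
Unique-dedup (x ∷ xs) =
  All.tabulate (λ {y} y∈ x≡y → proj₂ (∈-filter⁻ (¬? ∘ eqL? x) {xs = deduplicateᵇ eqL xs} y∈)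
                                     (Equivalence.from (T-eqL x y) x≡y))
  ∷ Unique.filter⁺ (¬? ∘ eqL? x) (Unique-dedup xs)

∈-patterns⁻ : ∀ y {z} → z ∈ patterns y → ∃ λ t → t ∈ subs y × z ≡ st t
∈-patterns⁻ y z∈ = ∈-map⁻ st (∈-dedup⁻ (map st (subs y)) z∈)

patterns-IsPerm : ∀ {y z} → Unique y → z ∈ patterns y → IsPerm z
patterns-IsPerm {y} u z∈ with ∈-patterns⁻ y z∈
... | t , t∈ , refl = st-IsPerm (subs-Unique t∈ u)

patterns-Bounded : ∀ {y z} → Unique y → z ∈ patterns y → Bounded z
patterns-Bounded u = IsPerm⇒Bounded ∘ patterns-IsPerm u

patterns-rc : ∀ {y} → IsPerm y → patterns (rc y) ↭ map rc (patterns y)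
patterns-rc {y} (u , bounds) = ∼bag⇒↭ (unique∧set⇒bag
  (Unique-dedup _)
  (Unique-map⁺-on (λ z∈ w∈ → rc-injective (patterns-Bounded u z∈) (patterns-Bounded u w∈)) (Unique-dedup _))
  (mk⇔ to from))
  where
  m = length y
  standardised-rc : map st (subs (rc y)) ↭ map rc (map st (subs y))
  standardised-rc = begin
    map st (subs (rc y))
      ≡⟨ cong (map st) (subs-map (λ x → suc m ∸ x) (reverse y)) ⟩
    map st (map (map (λ x → suc m ∸ x)) (subs (reverse y)))
      ↭⟨ map⁺ st (map⁺ (map (λ x → suc m ∸ x)) (subs-reverse y)) ⟩
    map st (map (map (λ x → suc m ∸ x)) (map reverse (subs y)))
      ≡⟨ trans (sym (map-∘ _)) (sym (map-∘ (subs y))) ⟩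
    map (st ∘ rc[ m ]_) (subs y)
      ≡⟨ map-cong-local (All.tabulate (λ t∈ →
           st-rc[] m (subs-Unique t∈ u) (subs-All t∈ (IsPerm⇒Bounded (u , bounds))))) ⟩
    map (rc ∘ st) (subs y)
      ≡⟨ map-∘ (subs y) ⟩
    map rc (map st (subs y)) ∎
    where open PermutationReasoning
  to : ∀ {z} → z ∈ patterns (rc y) → z ∈ map rc (patterns y)
  to z∈ with ∈-map⁻ rc (∈-resp-↭ standardised-rc (∈-dedup⁻ _ z∈))
  ... | w , w∈ , refl = ∈-map⁺ rc (∈-dedup⁺ w∈)
  from : ∀ {z} → z ∈ map rc (patterns y) → z ∈ patterns (rc y)
  from z∈ with ∈-map⁻ rc z∈
  ... | w , w∈ , refl = ∈-dedup⁺ (∈-resp-↭ (↭-sym standardised-rc) (∈-map⁺ rc (∈-dedup⁻ _ w∈)))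

-- The Möbius function and S

≼ᵇ-rc : ∀ {x y} → Bounded x → Bounded y → ≼ᵇ (rc x) (rc y) ≡ ≼ᵇ x y
≼ᵇ-rc bx by = cong (0 <ᵇ_) (E-rc bx by)

muF-cases : ℕ → Perm → Perm → Bool → Bool → ℤ
muF-cases fuel    x y false _     = ℤ.+ 0
muF-cases fuel    x y true  true  = ℤ.+ 1
muF-cases zero    x y true  false = ℤ.+ 0
muF-cases (suc f) x y true  false = ℤ.- sumWhere (muF f x) (λ z → ≼ᵇ x z ∧ not (eqL z y)) (patterns y)

muF-unfold : ∀ f x y → muF f x y ≡ muF-cases f x y (≼ᵇ x y) (eqL x y)
muF-unfold f x y with ≼ᵇ x y | eqL x y
... | false | _     = refl
... | true  | true  = refl
... | true  | false with f
... | zero  = refl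
... | suc g = refl

muF-rc : ∀ f {x y} → Bounded x → IsPerm y → muF f (rc x) (rc y) ≡ muF f x y
muF-rc f {x} {y} bx py@(u , _) = begin
  muF f (rc x) (rc y)
    ≡⟨ muF-unfold f (rc x) (rc y) ⟩
  muF-cases f (rc x) (rc y) (≼ᵇ (rc x) (rc y)) (eqL (rc x) (rc y))
    ≡⟨ cong₂ (muF-cases f (rc x) (rc y)) (≼ᵇ-rc bx by) (eqL-rc bx by) ⟩
  muF-cases f (rc x) (rc y) (≼ᵇ x y) (eqL x y)
    ≡⟨ cases f (≼ᵇ x y) (eqL x y) ⟩
  muF-cases f x y (≼ᵇ x y) (eqL x y)
    ≡⟨ muF-unfold f x y ⟨
  muF f x y ∎
  where
  open ≡-Reasoning
  by = IsPerm⇒Bounded py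
  below : Perm → Perm → Perm → Bool
  below x y z = ≼ᵇ x z ∧ not (eqL z y)
  cases : ∀ f b e → muF-cases f (rc x) (rc y) b e ≡ muF-cases f x y b e
  cases f       false _     = refl
  cases f       true  true  = refl
  cases zero    true  false = refl
  cases (suc g) true  false = cong ℤ.-_ (begin
    sumWhere (muF g (rc x)) (below (rc x) (rc y)) (patterns (rc y))
      ≡⟨ sumWhere-↭ (muF g (rc x)) (below (rc x) (rc y)) (patterns-rc py) ⟩
    sumWhere (muF g (rc x)) (below (rc x) (rc y)) (map rc (patterns y))
      ≡⟨ sumWhere-map (muF g (rc x)) (below (rc x) (rc y)) rc (patterns y) ⟩
    sumWhere (muF g (rc x) ∘ rc) (below (rc x) (rc y) ∘ rc) (patterns y)
      ≡⟨ sumWhere-cong _ _ _ _ (patterns y) (λ {z} z∈ →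
           cong₂ (λ a b → a ∧ not b) (≼ᵇ-rc {x} {z} bx (patterns-Bounded u z∈))
                                     (eqL-rc {z} {y} (patterns-Bounded u z∈) by) ,
           muF-rc g bx (patterns-IsPerm u z∈)) ⟩
    sumWhere (muF g x) (below x y) (patterns y) ∎)

μ-rc : ∀ {x y} → Bounded x → IsPerm y → μ (rc x) (rc y) ≡ μ x y
μ-rc {x} {y} bx py =
  trans (cong (λ m → muF (suc m) (rc x) (rc y)) (length-rc y)) (muF-rc (suc (length y)) bx py)

S-rc : ∀ n {l} → IsPerm (πn n) → rc (πn n) ≡ πn n → Bounded l → S n (rc l) ≡ S n l
S-rc n {l} pπ@(u , _) rcπ≡π bl = begin
  sumWhere signedE (≼ᵇ (rc l)) (patterns π)
    ≡⟨ sumWhere-↭ signedE (≼ᵇ (rc l)) (subst (λ π′ → patterns π′ ↭ map rc (patterns π)) rcπ≡π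
                                              (patterns-rc pπ)) ⟩
  sumWhere signedE (≼ᵇ (rc l)) (map rc (patterns π))
    ≡⟨ sumWhere-map signedE (≼ᵇ (rc l)) rc (patterns π) ⟩
  sumWhere (signedE ∘ rc) (≼ᵇ (rc l) ∘ rc) (patterns π)
    ≡⟨ sumWhere-cong _ _ _ _ (patterns π) (λ {τ} τ∈ →
         ≼ᵇ-rc {l} {τ} bl (patterns-Bounded u τ∈) ,
         cong₂ (λ k e → sgn k ℤ.* ℤ.+ e) (length-rc τ)
               (trans (cong (E (rc τ)) (sym rcπ≡π)) (E-rc {τ} {π} (patterns-Bounded u τ∈) (IsPerm⇒Bounded pπ)))) ⟩
  sumWhere signedE (≼ᵇ l) (patterns π) ∎
  where
  open ≡-Reasoning
  π = πn n
  signedE : Perm → ℤ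
  signedE τ = sgn (length τ) ℤ.* ℤ.+ (E τ π)

-- The permutation π_n

pair : ℕ → ℕ → List ℕ
pair a k = suc k ∷ a + suc k ∷ []

pairs : ℕ → ℕ → List ℕ
pairs a n = concat (map (pair a) (upTo n))

pairs-suc : ∀ a n → pairs a (suc n) ≡ pairs a n ++ pair a n
pairs-suc a n = begin
  concat (map (pair a) (upTo (suc n)))         ≡⟨ cong (concat ∘ map (pair a)) (sym (applyUpTo-∷ʳ id n)) ⟩
  concat (map (pair a) (upTo n ∷ʳ n))          ≡⟨ cong concat (map-++ (pair a) (upTo n) (n ∷ [])) ⟩
  concat (map (pair a) (upTo n) ∷ʳ pair a n)   ≡⟨ sym (concat-++ (map (pair a) (upTo n)) (pair a n ∷ [])) ⟩
  pairs a n ++ pair a n ++ []                  ≡⟨ cong (pairs a n ++_) (++-identityʳ (pair a n)) ⟩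
  pairs a n ++ pair a n                        ∎
  where open ≡-Reasoning

length-pairs : ∀ a n → length (pairs a n) ≡ n + n
length-pairs a zero    = refl
length-pairs a (suc n) = begin
  length (pairs a (suc n))        ≡⟨ cong length (pairs-suc a n) ⟩
  length (pairs a n ++ pair a n)  ≡⟨ length-++ (pairs a n) ⟩
  length (pairs a n) + 2          ≡⟨ cong (_+ 2) (length-pairs a n) ⟩
  n + n + 2                       ≡⟨ arith n ⟩
  suc n + suc n                   ∎
  where
  open ≡-Reasoning
  arith : ∀ n → n + n + 2 ≡ suc n + suc n
  arith = solve-∀

∈-pairs⁻ : ∀ a n {v} → v ∈ pairs a n → (1 ≤ v × v ≤ n) ⊎ (suc a ≤ v × v ≤ a + n)
∈-pairs⁻ a (suc n) {v} v∈ with ∈-++⁻ (pairs a n) (subst (v ∈_) (pairs-suc a n) v∈)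
... | inj₁ v∈′ with ∈-pairs⁻ a n v∈′
...   | inj₁ (1≤v , v≤n)  = inj₁ (1≤v , m≤n⇒m≤1+n v≤n)
...   | inj₂ (a<v , v≤an) = inj₂ (a<v , ≤-trans v≤an (+-monoʳ-≤ a (n≤1+n n)))
∈-pairs⁻ a (suc n) v∈ | inj₂ (here refl)         = inj₁ (s≤s z≤n , ≤-refl)
∈-pairs⁻ a (suc n) v∈ | inj₂ (there (here refl)) =
  inj₂ (≤-trans (s≤s (m≤m+n a n)) (≤-reflexive (sym (+-suc a n))) , ≤-refl)

Unique-pairs : ∀ a n → n ≤ a → Unique (pairs a n)
Unique-pairs a zero    _   = []
Unique-pairs a (suc n) n<a = subst Unique (sym (pairs-suc a n))
  (Unique.++⁺ (Unique-pairs a n (≤-trans (n≤1+n n) n<a)) (((<⇒≢ n<an) ∷ []) ∷ [] ∷ []) disjoint)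
  where
  n<an : suc n < a + suc n
  n<an = +-monoˡ-≤ (suc n) (≤-trans (s≤s z≤n) n<a)
  disjoint : ∀ {v} → ¬ (v ∈ pairs a n × v ∈ pair a n)
  disjoint (v∈ , here refl) with ∈-pairs⁻ a n v∈
  ... | inj₁ (_ , v≤n) = <-irrefl refl v≤n
  ... | inj₂ (a<v , _) = <⇒≱ (≤-trans (s≤s n<a) a<v) ≤-refl
  disjoint (v∈ , there (here refl)) with ∈-pairs⁻ a n v∈
  ... | inj₁ (_ , v≤n)  = <⇒≱ (≤-trans (n<1+n n) (<⇒≤ n<an)) v≤n
  ... | inj₂ (_ , v≤an) = <⇒≱ (+-monoʳ-< a (n<1+n n)) v≤an

length-πn : ∀ n → length (πn n) ≡ suc (suc (n + n))
length-πn n = cong suc (begin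
  length (pairs (n + 2) n ++ n + 2 ∷ [])  ≡⟨ length-++ (pairs (n + 2) n) ⟩
  length (pairs (n + 2) n) + 1            ≡⟨ cong (_+ 1) (length-pairs (n + 2) n) ⟩
  n + n + 1                               ≡⟨ +-comm (n + n) 1 ⟩
  suc (n + n)                             ∎)
  where open ≡-Reasoning

IsPerm-πn : ∀ n → IsPerm (πn n)
IsPerm-πn n =
  (All.tabulate first-fresh ∷ Unique.++⁺ (Unique-pairs (n + 2) n (m≤m+n n 2)) ([] ∷ []) last-fresh) ,
  subst (λ m → All (λ v → 1 ≤ v × v ≤ m) (πn n)) (sym (length-πn n))
    ((s≤s z≤n , s≤s (≤-trans (m≤m+n n n) (n≤1+n _))) ∷
     All.++⁺ (All.tabulate pair-bounds) ((≤-trans (s≤s z≤n) (m≤n+m 2 n) , last≤) ∷ []))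
  where
  last-fresh : ∀ {v} → ¬ (v ∈ pairs (n + 2) n × v ∈ n + 2 ∷ [])
  last-fresh (v∈ , here refl) with ∈-pairs⁻ (n + 2) n v∈
  ... | inj₁ (_ , v≤n) = <⇒≱ (m<m+n n (s≤s z≤n)) v≤n
  ... | inj₂ (v>v , _) = <-irrefl refl v>v
  first-fresh : ∀ {v} → v ∈ pairs (n + 2) n ++ n + 2 ∷ [] → suc n ≢ v
  first-fresh v∈ refl with ∈-++⁻ (pairs (n + 2) n) v∈
  ... | inj₁ v∈′ with ∈-pairs⁻ (n + 2) n v∈′
  ...   | inj₁ (_ , v≤n) = <-irrefl refl v≤n
  ...   | inj₂ (a<v , _) = <⇒≱ (s≤s (m<m+n n (s≤s z≤n))) a<v
  first-fresh v∈ refl | inj₂ (here eq) = <-irrefl (trans eq (+-comm n 2)) ≤-refl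
  last≤ : n + 2 ≤ suc (suc (n + n))
  last≤ = subst (_≤ suc (suc (n + n))) (+-comm 2 n) (s≤s (s≤s (m≤m+n n n)))
  pair-bounds : ∀ {v} → v ∈ pairs (n + 2) n → 1 ≤ v × v ≤ suc (suc (n + n))
  pair-bounds v∈ with ∈-pairs⁻ (n + 2) n v∈
  ... | inj₁ (1≤v , v≤n)  = 1≤v , ≤-trans v≤n (≤-trans (m≤m+n n n) (≤-trans (n≤1+n _) (n≤1+n _)))
  ... | inj₂ (a<v , v≤an) = ≤-trans (s≤s z≤n) a<v , ≤-trans v≤an (≤-reflexive (arith n))
    where
    arith : ∀ n → n + 2 + n ≡ suc (suc (n + n))
    arith = solve-∀

-- The complement, with respect to C, of the (n ∸ 1 ∸ k)-th pair read backwards.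
pairᶜ : ℕ → ℕ → ℕ → ℕ → List ℕ
pairᶜ a C n k = C ∸ (a + suc (n ∸ suc k)) ∷ C ∸ (n ∸ k) ∷ []

complement-reverse-pairs : ∀ a C n → map (C ∸_) (reverse (pairs a n)) ≡ concat (map (pairᶜ a C n) (upTo n))
complement-reverse-pairs a C zero    = refl
complement-reverse-pairs a C (suc n) = begin
  map (C ∸_) (reverse (pairs a (suc n)))
    ≡⟨ cong (map (C ∸_) ∘ reverse) (pairs-suc a n) ⟩
  map (C ∸_) (reverse (pairs a n ++ pair a n))
    ≡⟨ cong (map (C ∸_)) (reverse-++ (pairs a n) (pair a n)) ⟩
  map (C ∸_) (reverse (pair a n) ++ reverse (pairs a n))
    ≡⟨ map-++ (C ∸_) (reverse (pair a n)) (reverse (pairs a n)) ⟩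
  C ∸ (a + suc n) ∷ C ∸ suc n ∷ map (C ∸_) (reverse (pairs a n))
    ≡⟨ cong (λ xs → C ∸ (a + suc n) ∷ C ∸ suc n ∷ xs) (complement-reverse-pairs a C n) ⟩
  C ∸ (a + suc n) ∷ C ∸ suc n ∷ concat (map (pairᶜ a C n) (upTo n))
    ≡⟨ cong (λ xs → C ∸ (a + suc n) ∷ C ∸ suc n ∷ concat xs)
            (trans (map-applyUpTo id (pairᶜ a C n) n) (sym (map-applyUpTo suc (pairᶜ a C (suc n)) n))) ⟩
  concat (map (pairᶜ a C (suc n)) (upTo (suc n))) ∎
  where open ≡-Reasoning

rc-πn : ∀ n → rc (πn n) ≡ πn n
rc-πn n = begin
  map (λ x → suc (length (πn n)) ∸ x) (reverse (πn n))
    ≡⟨ cong (λ m → map (λ x → suc m ∸ x) (reverse (πn n))) (length-πn n) ⟩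
  map (C ∸_) (reverse (πn n))
    ≡⟨ cong (map (C ∸_)) (trans (unfold-reverse (suc n) (pairs a n ++ a ∷ []))
                                (cong (_∷ʳ suc n) (reverse-++ (pairs a n) (a ∷ [])))) ⟩
  map (C ∸_) ((a ∷ reverse (pairs a n)) ∷ʳ suc n)
    ≡⟨ map-++ (C ∸_) (a ∷ reverse (pairs a n)) (suc n ∷ []) ⟩
  (C ∸ a ∷ map (C ∸_) (reverse (pairs a n))) ∷ʳ (C ∸ suc n)
    ≡⟨ cong₂ (λ xs y → (C ∸ a ∷ xs) ∷ʳ y) (complement-reverse-pairs a C n) C∸n+1 ⟩
  (C ∸ a ∷ concat (map (pairᶜ a C n) (upTo n))) ∷ʳ a
    ≡⟨ cong₂ (λ x xs → (x ∷ concat xs) ∷ʳ a) C∸a (map-cong-local (All.tabulate (pairᶜ≡pair ∘ ∈-upTo⁻))) ⟩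
  πn n ∎
  where
  open ≡-Reasoning
  a = n + 2
  C = suc (suc (suc (n + n)))
  C∸a : C ∸ a ≡ suc n
  C∸a = trans (cong (_∸ a) (arith n)) (m+n∸m≡n a (suc n))
    where
    arith : ∀ n → suc (suc (suc (n + n))) ≡ n + 2 + suc n
    arith = solve-∀
  C∸n+1 : C ∸ suc n ≡ a
  C∸n+1 = trans (cong (_∸ suc n) (arith n)) (m+n∸m≡n (suc n) a)
    where
    arith : ∀ n → suc (suc (suc (n + n))) ≡ suc n + (n + 2)
    arith = solve-∀
  pairᶜ≡pair : ∀ {k} → k < n → pairᶜ a C n k ≡ pair a k
  pairᶜ≡pair {k} k<n with m≤n⇒∃[o]m+o≡n k<n
  ... | d , refl = cong₂ (λ x y → x ∷ y ∷ []) first second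
    where
    first : C ∸ (suc k + d + 2 + suc (suc k + d ∸ suc k)) ≡ suc k
    first rewrite m+n∸m≡n (suc k) d =
      trans (cong (_∸ (suc k + d + 2 + suc d)) (arith k d)) (m+n∸m≡n (suc k + d + 2 + suc d) (suc k))
      where
      arith : ∀ k d → suc (suc (suc ((suc k + d) + (suc k + d)))) ≡ (suc k + d + 2 + suc d) + suc k
      arith = solve-∀
    second : C ∸ (suc k + d ∸ k) ≡ suc k + d + 2 + suc k
    second rewrite +-∸-assoc 1 (m≤m+n k d) | m+n∸m≡n k d =
      trans (cong (_∸ suc d) (arith k d)) (m+n∸m≡n (suc d) _)
      where
      arith : ∀ k d → suc (suc (suc ((suc k + d) + (suc k + d)))) ≡ suc d + (suc k + d + 2 + suc k)
      arith = solve-∀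

-- Properness

record Complementary (m : ℕ) (l l′ : Perm) : Set where
  field
    length≡  : length l ≡ m
    length≡′ : length l′ ≡ m
    at-range : ∀ {k} → 1 ≤ k → k ≤ m → 1 ≤ at l k × at l k ≤ m
    at-compl : ∀ {k} → 1 ≤ k → k ≤ m → at l′ k ≡ suc m ∸ at l (suc m ∸ k)

module _ {m : ℕ} where

  private
    c : ℕ → ℕ
    c x = suc m ∸ x

  c-involutive : ∀ {k} → k ≤ m → c (c k) ≡ k
  c-involutive k≤m = m∸[m∸n]≡n (m≤n⇒m≤1+n k≤m)

  c-suc : ∀ {k} → k ≤ m → c k ≡ suc (m ∸ k)
  c-suc = +-∸-assoc 1

  c-range : ∀ {k} → 1 ≤ k → k ≤ m → 1 ≤ c k × c k ≤ m
  c-range 1≤k k≤m = subst (1 ≤_) (sym (c-suc k≤m)) (s≤s z≤n) , ∸-monoʳ-≤ (suc m) 1≤k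

  c-reflects-≤ : ∀ {x y} → x ≤ m → c y ≤ c x → x ≤ y
  c-reflects-≤ {x} {y} x≤m cy≤cx with <-cmp y x
  ... | tri< y<x _ _ = ⊥-elim (<⇒≱ (∸-monoʳ-< y<x (m≤n⇒m≤1+n x≤m)) cy≤cx)
  ... | tri≈ _ refl _ = ≤-refl
  ... | tri> _ _ y>x = <⇒≤ y>x

  Complementary-sym : ∀ {l l′} → Complementary m l l′ → Complementary m l′ l
  Complementary-sym {l} {l′} record { length≡ = len ; length≡′ = len′ ; at-range = range ; at-compl = compl } =
    record { length≡ = len′ ; length≡′ = len ; at-range = range′ ; at-compl = compl′ }
    where
    range′ : ∀ {k} → 1 ≤ k → k ≤ m → 1 ≤ at l′ k × at l′ k ≤ m
    range′ 1≤k k≤m with c-range 1≤k k≤m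
    ... | 1≤ck , ck≤m = subst (λ v → 1 ≤ v × v ≤ m) (sym (compl 1≤k k≤m))
                              (uncurry c-range (range 1≤ck ck≤m))
    compl′ : ∀ {k} → 1 ≤ k → k ≤ m → at l k ≡ c (at l′ (c k))
    compl′ {k} 1≤k k≤m with c-range 1≤k k≤m
    ... | 1≤ck , ck≤m = begin
      at l k              ≡⟨ c-involutive (proj₂ (range 1≤k k≤m)) ⟨
      c (c (at l k))      ≡⟨ cong (λ p → c (c (at l p))) (c-involutive k≤m) ⟨
      c (c (at l (c (c k)))) ≡⟨ cong c (compl 1≤ck ck≤m) ⟨
      c (at l′ (c k))     ∎
      where open ≡-Reasoning

rc-Complementary : ∀ {l} → IsPerm l → Complementary (length l) l (rc l)
rc-Complementary {l} (_ , bounds) = record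
  { length≡  = refl
  ; length≡′ = length-rc l
  ; at-range = λ { {suc k} _ k<m → nth-All bounds k<m }
  ; at-compl = λ { {suc k} _ k<m →
      trans (nth-rc[] (length l) l k<m) (cong (λ p → suc (length l) ∸ at l p) (sym (∸≡suc-mirror k<m))) }
  }

UniqueInvDesc ProperEnds ProperRepetitions : Perm → ℕ → ℕ → Set
UniqueInvDesc l i j = InvDesc l i j × (∀ i′ j′ → InvDesc l i′ j′ → i′ ≡ i × j′ ≡ j)
ProperEnds l i j = Top l i j 1 × Top l i j (length l ∸ 1) × Bot l i j 2 × Bot l i j (length l)
ProperRepetitions l i j =
  (∀ k k′ → TopRep l i j k → TopRep l i j k′ → k ≡ k′) ×
  (∀ k k′ → BotRep l i j k → BotRep l i j k′ → k ≡ k′) ×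
  (∀ k k′ → TopRep l i j k → BotRep l i j k′ → k < k′)

module Complemented {m l l′} (C : Complementary m l l′) where

  open Complementary C

  private
    c : ℕ → ℕ
    c x = suc m ∸ x

  ≤-compl : ∀ {a b} → 1 ≤ a → a ≤ m → 1 ≤ b → b ≤ m →
            at l′ a ≤ at l′ b ⇔ at l (c b) ≤ at l (c a)
  ≤-compl {a} {b} 1≤a a≤m 1≤b b≤m = mk⇔
    (λ h → c-reflects-≤ (proj₂ (at-range 1≤cb cb≤m)) (subst₂ _≤_ (at-compl 1≤a a≤m) (at-compl 1≤b b≤m) h))
    (λ h → subst₂ _≤_ (sym (at-compl 1≤a a≤m)) (sym (at-compl 1≤b b≤m)) (∸-monoʳ-≤ (suc m) h))
    where
    1≤cb = proj₁ (c-range 1≤b b≤m)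
    cb≤m = proj₂ (c-range 1≤b b≤m)

  InvDesc-range : ∀ {i j} → InvDesc l i j → (1 ≤ i × i ≤ m) × (1 ≤ j × j ≤ m)
  InvDesc-range (1≤i , i<j , j≤len , _) =
    (1≤i , ≤-trans (<⇒≤ i<j) j≤m) , (≤-trans 1≤i (<⇒≤ i<j) , j≤m)
    where
    j≤m = subst (_ ≤_) length≡ j≤len

  InvDesc-compl : ∀ {a b} → InvDesc l a b → InvDesc l′ (c b) (c a)
  InvDesc-compl {a} {b} desc@(_ , a<b , _ , a≡b+1) with InvDesc-range desc
  ... | (1≤a , a≤m) , (1≤b , b≤m) =
    proj₁ (c-range 1≤b b≤m) ,
    ∸-monoʳ-< a<b (m≤n⇒m≤1+n b≤m) ,
    subst (c a ≤_) (sym length≡′) (proj₂ (c-range 1≤a a≤m)) ,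
    (begin
      at l′ (c b)              ≡⟨ at-compl (proj₁ (c-range 1≤b b≤m)) (proj₂ (c-range 1≤b b≤m)) ⟩
      c (at l (c (c b)))       ≡⟨ cong (c ∘ at l) (c-involutive b≤m) ⟩
      c (at l b)               ≡⟨ c-suc (proj₂ (at-range 1≤b b≤m)) ⟩
      suc (c (suc (at l b)))   ≡⟨ cong (suc ∘ c) a≡b+1 ⟨
      suc (c (at l a))         ≡⟨ cong (suc ∘ c ∘ at l) (c-involutive a≤m) ⟨
      suc (c (at l (c (c a)))) ≡⟨ cong suc (at-compl (proj₁ (c-range 1≤a a≤m)) (proj₂ (c-range 1≤a a≤m))) ⟨
      suc (at l′ (c a))        ∎)
    where open ≡-Reasoning

  module _ {i j} (desc : InvDesc l i j) where

    private
      i-range = proj₁ (InvDesc-range desc)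
      j-range = proj₂ (InvDesc-range desc)

    Top-compl : ∀ {k} → 1 ≤ k → k ≤ m → Top l′ (c j) (c i) k ⇔ Bot l i j (c k)
    Top-compl 1≤k k≤m with c-range (proj₁ j-range) (proj₂ j-range)
    ... | 1≤cj , cj≤m = subst (λ p → Top l′ (c j) (c i) _ ⇔ (at l _ ≤ at l p))
                              (c-involutive (proj₂ j-range)) (≤-compl 1≤cj cj≤m 1≤k k≤m)

    Bot-compl : ∀ {k} → 1 ≤ k → k ≤ m → Bot l′ (c j) (c i) k ⇔ Top l i j (c k)
    Bot-compl 1≤k k≤m with c-range (proj₁ i-range) (proj₂ i-range)
    ... | 1≤ci , ci≤m = subst (λ p → Bot l′ (c j) (c i) _ ⇔ (at l p ≤ at l _))
                              (c-involutive (proj₂ i-range)) (≤-compl 1≤k k≤m 1≤ci ci≤m)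

    rep-compl : ∀ {P Q : ℕ → Set} → (∀ {k} → 1 ≤ k → k ≤ m → P k → Q (c k)) → ∀ {k} →
                1 ≤ k × suc k ≤ length l′ × P k × P (suc k) →
                1 ≤ m ∸ k × suc (m ∸ k) ≤ length l × Q (m ∸ k) × Q (suc (m ∸ k))
    rep-compl {Q = Q} P⇒Q {k} (1≤k , k<len , Pk , Pk+1) =
      subst (1 ≤_) (sym (∸≡suc-mirror k<m)) (s≤s z≤n) ,
      subst₂ _≤_ (c-suc k≤m) (sym length≡) (proj₂ (c-range 1≤k k≤m)) ,
      P⇒Q (s≤s z≤n) k<m Pk+1 ,
      subst Q (c-suc k≤m) (P⇒Q 1≤k k≤m Pk)
      where
      k<m = subst (suc k ≤_) length≡′ k<len
      k≤m = ≤-trans (n≤1+n k) k<m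

    TopRep-compl : ∀ {k} → TopRep l′ (c j) (c i) k → BotRep l i j (m ∸ k)
    TopRep-compl = rep-compl {Q = Bot l i j} (λ 1≤k k≤m → Equivalence.to (Top-compl 1≤k k≤m))

    BotRep-compl : ∀ {k} → BotRep l′ (c j) (c i) k → TopRep l i j (m ∸ k)
    BotRep-compl = rep-compl {Q = Top l i j} (λ 1≤k k≤m → Equivalence.to (Bot-compl 1≤k k≤m))

    2≤m : 2 ≤ m
    2≤m = ≤-trans (s≤s (proj₁ desc)) (≤-trans (proj₁ (proj₂ desc)) (proj₂ j-range))

    ProperEnds-compl : ProperEnds l i j → ProperEnds l′ (c j) (c i)
    ProperEnds-compl (top₁ , top₋₁ , bot₂ , botₘ) =
      Equivalence.from (Top-compl (s≤s z≤n) 1≤m) (subst (Bot l i j) length≡ botₘ) ,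
      subst (λ n → Top l′ (c j) (c i) (n ∸ 1)) (sym length≡′)
        (Equivalence.from (Top-compl 1≤m∸1 (m∸n≤m m 1)) (subst (Bot l i j) (sym c[m∸1]≡2) bot₂)) ,
      Equivalence.from (Bot-compl (s≤s z≤n) 2≤m) (subst (λ n → Top l i j (n ∸ 1)) length≡ top₋₁) ,
      subst (Bot l′ (c j) (c i)) (sym length≡′)
        (Equivalence.from (Bot-compl 1≤m ≤-refl) (subst (Top l i j) (sym (m+n∸n≡m 1 m)) top₁))
      where
      1≤m = ≤-trans (s≤s z≤n) 2≤m
      1≤m∸1 = subst (1 ≤_) (sym (∸≡suc-mirror 2≤m)) (s≤s z≤n)
      c[m∸1]≡2 : c (m ∸ 1) ≡ 2
      c[m∸1]≡2 = trans (c-suc (m∸n≤m m 1)) (cong suc (m∸[m∸n]≡n 1≤m))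

    ProperRepetitions-compl : ProperRepetitions l i j → ProperRepetitions l′ (c j) (c i)
    ProperRepetitions-compl (top-unique , bot-unique , top<bot) =
      (λ k k′ r r′ → ∸-injective (rep≤ r) (rep≤ r′) (bot-unique _ _ (TopRep-compl r) (TopRep-compl r′))) ,
      (λ k k′ r r′ → ∸-injective (rep≤ r) (rep≤ r′) (top-unique _ _ (BotRep-compl r) (BotRep-compl r′))) ,
      (λ k k′ r r′ → ∸-cancelʳ-< (top<bot _ _ (BotRep-compl r′) (TopRep-compl r)))
      where
      rep≤ : ∀ {k} {P : Set} → 1 ≤ k × suc k ≤ length l′ × P → k ≤ m
      rep≤ (_ , k<len , _) = ≤-trans (n≤1+n _) (subst (_ ≤_) length≡′ k<len)
      ∸-injective : ∀ {k k′} → k ≤ m → k′ ≤ m → m ∸ k ≡ m ∸ k′ → k ≡ k′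
      ∸-injective k≤m k′≤m eq = trans (sym (m∸[m∸n]≡n k≤m)) (trans (cong (m ∸_) eq) (m∸[m∸n]≡n k′≤m))

UniqueInvDesc-compl : ∀ {m l l′} → Complementary m l l′ → ∀ {i j} →
                      UniqueInvDesc l i j → UniqueInvDesc l′ (suc m ∸ j) (suc m ∸ i)
UniqueInvDesc-compl {m} {l} {l′} C {i} {j} (desc , desc-unique) = InvDesc-compl desc , desc-unique′
  where
  open Complemented C
  module C′ = Complemented (Complementary-sym C)
  desc-unique′ : ∀ a b → InvDesc l′ a b → a ≡ suc m ∸ j × b ≡ suc m ∸ i
  desc-unique′ a b desc′ with desc-unique _ _ (C′.InvDesc-compl desc′) | C′.InvDesc-range desc′
  ... | cb≡i , ca≡j | (_ , a≤m) , (_ , b≤m) =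
    trans (sym (c-involutive a≤m)) (cong (suc m ∸_) ca≡j) , trans (sym (c-involutive b≤m)) (cong (suc m ∸_) cb≡i)


p21-Bounded : Bounded p21
p21-Bounded = s≤s (s≤s z≤n) ∷ s≤s z≤n ∷ []

≼-rc : ∀ {σ π} → Bounded σ → Bounded π → σ ≼ π → rc σ ≼ rc π
≼-rc bσ bπ = subst (0 <_) (sym (E-rc bσ bπ))

Proper-rc : ∀ n {l} → Proper n l → Proper n (rc l)
Proper-rc n {l} (pl , 21≼l , l≼π , l≢π , i , j , unique@(desc , _) , ends , reps) =
  IsPerm-rc pl ,
  ≼-rc p21-Bounded bl 21≼l ,
  subst (rc l ≼_) (rc-πn n) (≼-rc bl (IsPerm⇒Bounded (IsPerm-πn n)) l≼π) ,
  (λ rcl≡π → l≢π (trans (sym (rc-involutive bl)) (trans (cong rc rcl≡π) (rc-πn n)))) ,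
  _ , _ ,
  UniqueInvDesc-compl C unique , ProperEnds-compl desc ends , ProperRepetitions-compl desc reps
  where
  bl = IsPerm⇒Bounded pl
  C = rc-Complementary pl
  open Complemented C

lemma18 : (n : ℕ) → 2 ≤ n → (l : Perm) → Proper n l →
    Proper n (rc l) × μ p21 l ≡ μ p21 (rc l) × S n l ≡ S n (rc l)
-- The symmetry holds for every n.
lemma18 n _ l proper@(pl , _) =
  Proper-rc n proper ,
  sym (μ-rc p21-Bounded pl) ,
  sym (S-rc n (IsPerm-πn n) (rc-πn n) (IsPerm⇒Bounded pl))
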